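{- Let $\mathcal{S}=(S,\{0,1\}^X)$ be a system, let $x\in X$, and let $\mathcal{S}'=\mathcal{S}|_{x=0}$ and $\mathcal{S}''=\mathcal{S}|_{x=1}$. The following are equivalent: (1) $\mathcal{S}$ is SE; (2) $\mathcal{S}'$ and $\mathcal{S}''$ are SE and $\mathrm{str}(\mathcal{S}')\oplus_x\mathrm{str}(\mathcal{S}'')=\mathrm{str}(\mathcal{S})$; (3) $\mathcal{S}'$ and $\mathcal{S}''$ are SE and $\mathrm{sstr}(\mathcal{S}')\oplus_x\mathrm{sstr}(\mathcal{S}'')=\mathrm{sstr}(\mathcal{S})$.
   Context: A system is $\mathcal{S}=(S,\{0,1\}^X)$ with $X$ finite and $S\subseteq\{0,1\}^X$. For disjoint $A,B$, $f\in\{0,1\}^A,g\in\{0,1\}^B$, $g\star f$ is the common extension to $A\cup B$. $\mathcal{S}$ shatters $Y\subseteq X$ if $\forall f\in\{0,1\}^Y\ \exists g\in\{0,1\}^{X\setminus Y}: g\star f\in S$; it strongly shatters $Y$ if $\exists g\in\{0,1\}^{X\setminus Y}\ \forall f\in\{0,1\}^Y: g\star f\in S$. $\mathrm{str}(\mathcal{S})$, $\mathrm{sstr}(\mathcal{S})$ are the families of shattered, resp. strongly shattered, subsets of $X$; $\mathcal{S}$ is SE if $\mathrm{sstr}(\mathcal{S})=\mathrm{str}(\mathcal{S})$. For $i\in\{0,1\}$, $\mathcal{S}|_{x=i}=(\{f|_{X\setminus\{x\}}: f\in S, f(x)=i\},\{0,1\}^{X\setminus\{x\}})$. For families of sets $A,B$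 and an object $x$, $A\oplus_x B=A\cup B\cup\{c\cup\{x\}: c\in A\cap B\}$. -}

module Defs where

open import Data.Nat using (ℕ; suc)
open import Data.Bool using (Bool; true; false; T; if_then_else_)
open import Data.Fin using (Fin)
open import Data.Vec using (Vec; zipWith; insertAt)
open import Data.Fin.Subset using (Subset)
open import Data.Product using (Σ; ∃; _×_; _,_)
open import Data.Sum using (_⊎_)
open import Relation.Binary.PropositionalEquality using (_≡_)
open import Relation.Unary using (Pred; _≐_)
open import Level using (0ℓ)

-- The ground set X is Fin m.  An element of {0,1}^X is a vector Vec Bool m.
-- A system (S, {0,1}^X) is given by (the characteristic function of) S ⊆ {0,1}^X.
System : ℕ → Set
System m = Vec Bool m → Bool

_∈S_ : ∀ {m} → Vec Bool m → System m → Set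
f ∈S S = T (S f)

Family : ℕ → Set₁
Family m = Pred (Subset m) 0ℓ

-- g ⋆ f for f ∈ {0,1}^Y and g ∈ {0,1}^(X∖Y): the assignment agreeing with f on Y and
-- with g off Y (f and g are represented by arbitrary total vectors; only their
-- values on Y, resp. X∖Y, are used).
glue : ∀ {m} → Subset m → Vec Bool m → Vec Bool m → Vec Bool m
glue Y g f = zipWith (λ y p → if y then proj₁' p else proj₂' p) Y (zipWith _,_ f g)
  where
  proj₁' : Bool × Bool → Bool
  proj₁' (a , _) = a
  proj₂' : Bool × Bool → Bool
  proj₂' (_ , b) = b

str : ∀ {m} → System m → Family m
str S Y = ∀ f → ∃ λ g → glue Y g f ∈S S

sstr : ∀ {m} → System m → Family m
sstr S Y = ∃ λ g → ∀ f → glue Y g f ∈S S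

SE : ∀ {m} → System m → Set
SE S = sstr S ≐ str S

-- Restriction S|_{x=i} on X∖{x} ≅ Fin n (X = Fin (suc n)):
-- { f|_{X∖{x}} : f ∈ S, f(x) = i } ; f' belongs iff its extension by f'(x)=i lies in S.
restrict : ∀ {n} → System (suc n) → Fin (suc n) → Bool → System n
restrict S x i f' = S (insertAt f' x i)

-- A ⊕_x B = A ∪ B ∪ { c ∪ {x} : c ∈ A ∩ B }, families over X∖{x} viewed inside X.
_⊕⟨_⟩_ : ∀ {n} → Family n → Fin (suc n) → Family n → Family (suc n)
(A ⊕⟨ x ⟩ B) Z = ∃ λ c →
    (Z ≡ insertAt c x false × (A c ⊎ B c))
  ⊎ (Z ≡ insertAt c x true × (A c × B c))

-- Counting gives Pajor's inequalities |sstr S| ≤ |S| ≤ |str S|, and S is SE exactly when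
-- either of them is an equality.  Split S along x into S′ and S″.  For c ⊆ X∖{x}:
-- c is shattered by S iff by S′ ∪ S″, c ∪ {x} iff by both S′ and S″; c is strongly
-- shattered iff by S′ or by S″, c ∪ {x} iff by S′ ∩ S″.  Hence
--   |str S| = |str (S′ ∪ S″)| + |str S′ ∩ str S″| ≥ |str S′| + |str S″| ≥ |S′| + |S″| = |S|,
--   |sstr S| = |sstr S′ ∪ sstr S″| + |sstr (S′ ∩ S″)| ≤ |sstr S′| + |sstr S″| ≤ |S′| + |S″| = |S|,
-- and S is SE iff one (equivalently, the other) chain is tight: S′ and S″ are SE and
-- str (S′ ∪ S″) = str S′ ∪ str S″, resp. sstr (S′ ∩ S″) = sstr S′ ∩ sstr S″.  These last
-- equalities say precisely that str S, resp. sstr S, is the ⊕ₓ of the restrictions.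
-- Running the same chains through an induction on |X| proves that tightness implies SE.

module Submission where

open import Algebra.Properties.CommutativeSemigroup using (interchange)
open import Data.Bool using (Bool; true; false; if_then_else_; _∧_; _∨_)
open import Data.Bool.Properties using (T-∧; T-∨)
open import Data.Empty using (⊥-elim)
open import Data.Fin using (Fin; zero; suc)
open import Data.Fin.Subset.Properties using (anySubset?)
open import Data.Nat using (ℕ; zero; suc; _+_; _≤_; z≤n)
open import Data.Nat.Properties
  using (≤-refl; ≤-trans; ≤-antisym; +-mono-≤; +-monoˡ-≤; +-monoʳ-≤; +-cancelˡ-≤; +-cancelʳ-≤;
         +-commutativeSemigroup; module ≤-Reasoning)
open import Data.Product using (_×_; _,_; ∃; ∃₂; proj₁; proj₂) renaming (map to ×-map)
open import Data.Product.Function.NonDependent.Propositional using (_×-⇔_)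
open import Data.Sum using (_⊎_; inj₁; inj₂; [_,_]) renaming (map to ⊎-map)
open import Data.Vec using (Vec; []; _∷_; insertAt; removeAt; lookup)
open import Data.Vec.Properties using (insertAt-lookup; removeAt-insertAt; insertAt-removeAt)
open import Function using (_∘_)
open import Function.Bundles using (_⇔_; mk⇔; module Equivalence)
open import Function.Properties.Equivalence using () renaming (trans to ⇔-trans; sym to ⇔-sym)
open import Relation.Binary.PropositionalEquality
  using (_≡_; refl; sym; trans; cong; cong₂; subst; module ≡-Reasoning)
open import Relation.Nullary using (Dec; yes; no; does; ¬?; map′; decidable-stable)
open import Relation.Nullary.Decidable using (T?)
open import Relation.Unary using (Decidable; _⊆_; _≐_; _∪_; _∩_)
open import Relation.Unary.Properties using (_∪?_; _∩?_)

open import Defs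

+-mono-≤-tight : ∀ {a b c d} → a ≤ c → b ≤ d → c + d ≤ a + b → c ≤ a × d ≤ b
+-mono-≤-tight {a} {b} {c} {d} a≤c b≤d c+d≤a+b =
  +-cancelʳ-≤ d c a (≤-trans c+d≤a+b (+-monoʳ-≤ a b≤d)) ,
  +-cancelˡ-≤ c d b (≤-trans c+d≤a+b (+-monoˡ-≤ b a≤c))

count : ∀ {m} {P : Family m} → Decidable P → ℕ
count {zero}  P? = if does (P? []) then 1 else 0
count {suc m} P? = count (P? ∘ (false ∷_)) + count (P? ∘ (true ∷_))

count-mono : ∀ {m} {P Q : Family m} (P? : Decidable P) (Q? : Decidable Q) →
             P ⊆ Q → count P? ≤ count Q?
count-mono {zero} P? Q? P⊆Q with P? [] | Q? []
... | no _  | _     = z≤n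
... | yes _ | yes _ = ≤-refl
... | yes p | no ¬q = ⊥-elim (¬q (P⊆Q p))
count-mono {suc m} P? Q? P⊆Q =
  +-mono-≤ (count-mono (P? ∘ (false ∷_)) (Q? ∘ (false ∷_)) P⊆Q)
           (count-mono (P? ∘ (true ∷_)) (Q? ∘ (true ∷_)) P⊆Q)

count-cong : ∀ {m} {P Q : Family m} (P? : Decidable P) (Q? : Decidable Q) →
             P ≐ Q → count P? ≡ count Q?
count-cong P? Q? (P⊆Q , Q⊆P) = ≤-antisym (count-mono P? Q? P⊆Q) (count-mono Q? P? Q⊆P)

⊆-count-≤⇒⊇ : ∀ {m} {P Q : Family m} (P? : Decidable P) (Q? : Decidable Q) →
              P ⊆ Q → count Q? ≤ count P? → Q ⊆ P
⊆-count-≤⇒⊇ {zero} P? Q? P⊆Q Q≤P {[]} q with P? [] | Q? []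
... | yes p | _     = p
... | no _  | no ¬q = ⊥-elim (¬q q)
... | no _  | yes _ with Q≤P
...   | ()
⊆-count-≤⇒⊇ {suc m} {P} {Q} P? Q? P⊆Q Q≤P {b ∷ v} = ⊇ b
  where
  tight = +-mono-≤-tight (count-mono (P? ∘ (false ∷_)) (Q? ∘ (false ∷_)) P⊆Q)
                  (count-mono (P? ∘ (true ∷_)) (Q? ∘ (true ∷_)) P⊆Q) Q≤P
  ⊇ : ∀ b → Q (b ∷ v) → P (b ∷ v)
  ⊇ false = ⊆-count-≤⇒⊇ (P? ∘ (false ∷_)) (Q? ∘ (false ∷_)) P⊆Q (proj₁ tight)
  ⊇ true  = ⊆-count-≤⇒⊇ (P? ∘ (true ∷_)) (Q? ∘ (true ∷_)) P⊆Q (proj₂ tight)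

count-∪+count-∩ : ∀ {m} {P Q : Family m} (P? : Decidable P) (Q? : Decidable Q) →
                  count (P? ∪? Q?) + count (P? ∩? Q?) ≡ count P? + count Q?
count-∪+count-∩ {zero} P? Q? with does (P? []) | does (Q? [])
... | false | false = refl
... | false | true  = refl
... | true  | false = refl
... | true  | true  = refl
count-∪+count-∩ {suc m} P? Q? = begin
  (∪₀ + ∪₁) + (∩₀ + ∩₁) ≡⟨ interchange +-commutativeSemigroup ∪₀ ∪₁ ∩₀ ∩₁ ⟩
  (∪₀ + ∩₀) + (∪₁ + ∩₁) ≡⟨ cong₂ _+_ (count-∪+count-∩ (P? ∘ (false ∷_)) (Q? ∘ (false ∷_)))
                                     (count-∪+count-∩ (P? ∘ (true ∷_)) (Q? ∘ (true ∷_))) ⟩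
  (P₀ + Q₀) + (P₁ + Q₁) ≡⟨ interchange +-commutativeSemigroup P₀ Q₀ P₁ Q₁ ⟩
  (P₀ + P₁) + (Q₀ + Q₁) ∎
  where
  open ≡-Reasoning
  ∪₀ = count ((P? ∪? Q?) ∘ (false ∷_))
  ∪₁ = count ((P? ∪? Q?) ∘ (true ∷_))
  ∩₀ = count ((P? ∩? Q?) ∘ (false ∷_))
  ∩₁ = count ((P? ∩? Q?) ∘ (true ∷_))
  P₀ = count (P? ∘ (false ∷_))
  P₁ = count (P? ∘ (true ∷_))
  Q₀ = count (Q? ∘ (false ∷_))
  Q₁ = count (Q? ∘ (true ∷_))

section : ∀ {n} → Family (suc n) → Fin (suc n) → Bool → Family n
section P x b c = P (insertAt c x b)

count-sections : ∀ {n} {P : Family (suc n)} (x : Fin (suc n)) (P? : Decidable P) →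
                 count P? ≡ count (λ c → P? (insertAt c x false)) + count (λ c → P? (insertAt c x true))
count-sections zero P? = refl
count-sections {suc n} (suc x) P? = begin
  (P₀ + P₁) ≡⟨ cong₂ _+_ (count-sections x (P? ∘ (false ∷_))) (count-sections x (P? ∘ (true ∷_))) ⟩
  (P₀₀ + P₀₁) + (P₁₀ + P₁₁) ≡⟨ interchange +-commutativeSemigroup P₀₀ P₀₁ P₁₀ P₁₁ ⟩
  (P₀₀ + P₁₀) + (P₀₁ + P₁₁) ∎
  where
  open ≡-Reasoning
  P₀ = count (P? ∘ (false ∷_))
  P₁ = count (P? ∘ (true ∷_))
  P₀₀ = count (λ c → P? (false ∷ insertAt c x false))
  P₀₁ = count (λ c → P? (false ∷ insertAt c x true))
  P₁₀ = count (λ c → P? (true ∷ insertAt c x false))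
  P₁₁ = count (λ c → P? (true ∷ insertAt c x true))

∀-by-sections : ∀ {n} {P : Family (suc n)} (x : Fin (suc n)) →
                (∀ c b → P (insertAt c x b)) → ∀ v → P v
∀-by-sections {P = P} x h v = subst P (insertAt-removeAt v x) (h (removeAt v x) (lookup v x))

∃-by-sections : ∀ {n} {P : Family (suc n)} (x : Fin (suc n)) →
                ∃ P → ∃₂ λ c b → P (insertAt c x b)
∃-by-sections {P = P} x (v , p) =
  removeAt v x , lookup v x , subst P (sym (insertAt-removeAt v x)) p

⊆-by-sections : ∀ {n} {P Q : Family (suc n)} (x : Fin (suc n)) →
                section P x false ⊆ section Q x false → section P x true ⊆ section Q x true →
                P ⊆ Q
⊆-by-sections {P = P} {Q} x P₀⊆Q₀ P₁⊆Q₁ {v} = ∀-by-sections {P = λ v → P v → Q v} x sections v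
  where
  sections : ∀ c b → P (insertAt c x b) → Q (insertAt c x b)
  sections c false = P₀⊆Q₀
  sections c true  = P₁⊆Q₁

insertAt-injective : ∀ {n} (x : Fin (suc n)) {c c′ : Vec Bool n} {b b′ : Bool} →
                     insertAt c x b ≡ insertAt c′ x b′ → c ≡ c′ × b ≡ b′
insertAt-injective x {c} {c′} {b} {b′} eq =
  trans (sym (removeAt-insertAt c x b)) (trans (cong (λ v → removeAt v x) eq) (removeAt-insertAt c′ x b′)) ,
  trans (sym (insertAt-lookup c x b)) (trans (cong (λ v → lookup v x) eq) (insertAt-lookup c′ x b′))

module _ {n} {A B : Family n} (x : Fin (suc n)) where

  ⊕-section-false : section (A ⊕⟨ x ⟩ B) x false ≐ A ∪ B
  ⊕-section-false = to , λ {c} A∪B → c , inj₁ (refl , A∪B)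
    where
    to : section (A ⊕⟨ x ⟩ B) x false ⊆ A ∪ B
    to (c′ , inj₁ (eq , A∪B)) with insertAt-injective x eq
    ... | refl , _ = A∪B
    to (c′ , inj₂ (eq , _)) with insertAt-injective x eq
    ... | _ , ()

  ⊕-section-true : section (A ⊕⟨ x ⟩ B) x true ≐ A ∩ B
  ⊕-section-true = to , λ {c} A∩B → c , inj₂ (refl , A∩B)
    where
    to : section (A ⊕⟨ x ⟩ B) x true ⊆ A ∩ B
    to (c′ , inj₂ (eq , A∩B)) with insertAt-injective x eq
    ... | refl , _ = A∩B
    to (c′ , inj₁ (eq , _)) with insertAt-injective x eq
    ... | _ , ()

allSubset? : ∀ {m} {P : Family m} → Decidable P → Dec (∀ v → P v)
allSubset? P? = map′ (λ ¬∃¬P v → decidable-stable (P? v) (λ ¬Pv → ¬∃¬P (v , ¬Pv)))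
                     (λ ∀P (v , ¬Pv) → ¬Pv (∀P v))
                     (¬? (anySubset? (¬? ∘ P?)))

str? : ∀ {m} (S : System m) → Decidable (str S)
str? S Y = allSubset? λ f → anySubset? λ g → T? (S (glue Y g f))

sstr? : ∀ {m} (S : System m) → Decidable (sstr S)
sstr? S Y = anySubset? λ g → allSubset? λ f → T? (S (glue Y g f))

#_ #str_ #sstr_ : ∀ {m} → System m → ℕ
# S = count (λ v → T? (S v))
#str S = count (str? S)
#sstr S = count (sstr? S)

infixr 7 _∩ˢ_
infixr 6 _∪ˢ_

_∪ˢ_ _∩ˢ_ : ∀ {m} → System m → System m → System m
(S₁ ∪ˢ S₂) v = S₁ v ∨ S₂ v
(S₁ ∩ˢ S₂) v = S₁ v ∧ S₂ v

_⊆ˢ_ : ∀ {m} → System m → System m → Set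
S₁ ⊆ˢ S₂ = (_∈S S₁) ⊆ (_∈S S₂)

#∪ˢ+#∩ˢ : ∀ {m} (S₁ S₂ : System m) → # (S₁ ∪ˢ S₂) + # (S₁ ∩ˢ S₂) ≡ # S₁ + # S₂
#∪ˢ+#∩ˢ S₁ S₂ = trans
  (cong₂ _+_ (count-cong _ (S₁? ∪? S₂?) (Equivalence.to T-∨ , Equivalence.from T-∨))
             (count-cong _ (S₁? ∩? S₂?) (Equivalence.to T-∧ , Equivalence.from T-∧)))
  (count-∪+count-∩ S₁? S₂?)
  where
  S₁? = λ v → T? (S₁ v)
  S₂? = λ v → T? (S₂ v)

⊆ˢ-∪ˢˡ : ∀ {m} (S₁ S₂ : System m) → S₁ ⊆ˢ (S₁ ∪ˢ S₂)
⊆ˢ-∪ˢˡ S₁ S₂ = Equivalence.from T-∨ ∘ inj₁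

⊆ˢ-∪ˢʳ : ∀ {m} (S₁ S₂ : System m) → S₂ ⊆ˢ (S₁ ∪ˢ S₂)
⊆ˢ-∪ˢʳ S₁ S₂ = Equivalence.from T-∨ ∘ inj₂

∩ˢ-⊆ˢˡ : ∀ {m} (S₁ S₂ : System m) → (S₁ ∩ˢ S₂) ⊆ˢ S₁
∩ˢ-⊆ˢˡ S₁ S₂ = proj₁ ∘ Equivalence.to T-∧

∩ˢ-⊆ˢʳ : ∀ {m} (S₁ S₂ : System m) → (S₁ ∩ˢ S₂) ⊆ˢ S₂
∩ˢ-⊆ˢʳ S₁ S₂ = proj₂ ∘ Equivalence.to T-∧

str-mono : ∀ {m} {S₁ S₂ : System m} → S₁ ⊆ˢ S₂ → str S₁ ⊆ str S₂
str-mono S₁⊆S₂ shattered f = proj₁ (shattered f) , S₁⊆S₂ (proj₂ (shattered f))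

sstr-mono : ∀ {m} {S₁ S₂ : System m} → S₁ ⊆ˢ S₂ → sstr S₁ ⊆ sstr S₂
sstr-mono S₁⊆S₂ (g , shattered) = g , S₁⊆S₂ ∘ shattered

sstr⊆str : ∀ {m} (S : System m) → sstr S ⊆ str S
sstr⊆str S (g , shattered) f = g , shattered f

glue-insertAt : ∀ {n} (x : Fin (suc n)) (Y g f : Vec Bool n) (y b a : Bool) →
                glue (insertAt Y x y) (insertAt g x b) (insertAt f x a) ≡
                insertAt (glue Y g f) x (if y then a else b)
glue-insertAt zero Y g f y b a = refl
glue-insertAt {suc n} (suc x) (_ ∷ Y) (_ ∷ g) (_ ∷ f) y b a = cong (_ ∷_) (glue-insertAt x Y g f y b a)

str-∪⊆str-∪ˢ : ∀ {m} (S₁ S₂ : System m) → str S₁ ∪ str S₂ ⊆ str (S₁ ∪ˢ S₂)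
str-∪⊆str-∪ˢ S₁ S₂ =
  [ str-mono {S₂ = S₁ ∪ˢ S₂} (⊆ˢ-∪ˢˡ S₁ S₂) , str-mono {S₂ = S₁ ∪ˢ S₂} (⊆ˢ-∪ˢʳ S₁ S₂) ]

str-∩ˢ⊆str-∩ : ∀ {m} (S₁ S₂ : System m) → str (S₁ ∩ˢ S₂) ⊆ str S₁ ∩ str S₂
str-∩ˢ⊆str-∩ S₁ S₂ shattered =
  str-mono {S₁ = S₁ ∩ˢ S₂} (∩ˢ-⊆ˢˡ S₁ S₂) shattered , str-mono {S₁ = S₁ ∩ˢ S₂} (∩ˢ-⊆ˢʳ S₁ S₂) shattered

sstr-∪⊆sstr-∪ˢ : ∀ {m} (S₁ S₂ : System m) → sstr S₁ ∪ sstr S₂ ⊆ sstr (S₁ ∪ˢ S₂)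
sstr-∪⊆sstr-∪ˢ S₁ S₂ =
  [ sstr-mono {S₂ = S₁ ∪ˢ S₂} (⊆ˢ-∪ˢˡ S₁ S₂) , sstr-mono {S₂ = S₁ ∪ˢ S₂} (⊆ˢ-∪ˢʳ S₁ S₂) ]

sstr-∩ˢ⊆sstr-∩ : ∀ {m} (S₁ S₂ : System m) → sstr (S₁ ∩ˢ S₂) ⊆ sstr S₁ ∩ sstr S₂
sstr-∩ˢ⊆sstr-∩ S₁ S₂ shattered =
  sstr-mono {S₁ = S₁ ∩ˢ S₂} (∩ˢ-⊆ˢˡ S₁ S₂) shattered , sstr-mono {S₁ = S₁ ∩ˢ S₂} (∩ˢ-⊆ˢʳ S₁ S₂) shattered

module Split {n} (S : System (suc n)) (x : Fin (suc n)) where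

  S′ S″ : System n
  S′ = restrict S x false
  S″ = restrict S x true

  private
    -- The coordinate x of glue (insertAt c x y) g f is taken from f if y = true (x ∈ Y)
    -- and from g otherwise; a and b are those coordinates of f and g.
    Shattered Strongly-shattered : Bool → Family n
    Shattered y c = ∀ f a → ∃₂ λ g b → glue c g f ∈S restrict S x (if y then a else b)
    Strongly-shattered y c = ∃₂ λ g b → ∀ f a → glue c g f ∈S restrict S x (if y then a else b)

    str-section : ∀ y → section (str S) x y ≐ Shattered y
    str-section y = to , from
      where
      to : section (str S) x y ⊆ Shattered y
      to {c} shattered f a with ∃-by-sections x (shattered (insertAt f x a))
      ... | g , b , p = g , b , subst (_∈S S) (glue-insertAt x c g f y b a) p
      from : Shattered y ⊆ section (str S) x y
      from {c} h = ∀-by-sections x λ f a → let (g , b , p) = h f a in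
        insertAt g x b , subst (_∈S S) (sym (glue-insertAt x c g f y b a)) p

    sstr-section : ∀ y → section (sstr S) x y ≐ Strongly-shattered y
    sstr-section y = to , from
      where
      to : section (sstr S) x y ⊆ Strongly-shattered y
      to {c} shattered with ∃-by-sections x shattered
      ... | g , b , p = g , b , λ f a → subst (_∈S S) (glue-insertAt x c g f y b a) (p (insertAt f x a))
      from : Strongly-shattered y ⊆ section (sstr S) x y
      from {c} (g , b , p) = insertAt g x b , ∀-by-sections x λ f a →
        subst (_∈S S) (sym (glue-insertAt x c g f y b a)) (p f a)

    ∈∪ˢ⇒∈restrict : ∀ {c} → c ∈S (S′ ∪ˢ S″) → ∃ λ b → c ∈S restrict S x b
    ∈∪ˢ⇒∈restrict {c} p with Equivalence.to (T-∨ {S′ c} {S″ c}) p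
    ... | inj₁ p′ = false , p′
    ... | inj₂ p″ = true , p″

    ∈restrict⇒∈∪ˢ : ∀ b {c} → c ∈S restrict S x b → c ∈S (S′ ∪ˢ S″)
    ∈restrict⇒∈∪ˢ false = ⊆ˢ-∪ˢˡ S′ S″
    ∈restrict⇒∈∪ˢ true  = ⊆ˢ-∪ˢʳ S′ S″

    ∈∩ˢ⇒∈restrict : ∀ b {c} → c ∈S (S′ ∩ˢ S″) → c ∈S restrict S x b
    ∈∩ˢ⇒∈restrict false = ∩ˢ-⊆ˢˡ S′ S″
    ∈∩ˢ⇒∈restrict true  = ∩ˢ-⊆ˢʳ S′ S″

  str-section-false : section (str S) x false ≐ str (S′ ∪ˢ S″)
  str-section-false = to , from
    where
    to : section (str S) x false ⊆ str (S′ ∪ˢ S″)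
    to shattered f with proj₁ (str-section false) shattered f false
    ... | g , b , p = g , ∈restrict⇒∈∪ˢ b p
    from : str (S′ ∪ˢ S″) ⊆ section (str S) x false
    from shattered = proj₂ (str-section false) λ f _ →
      let (g , p) = shattered f ; (b , q) = ∈∪ˢ⇒∈restrict p in g , b , q

  str-section-true : section (str S) x true ≐ str S′ ∩ str S″
  str-section-true = to , from
    where
    to : section (str S) x true ⊆ str S′ ∩ str S″
    to {c} shattered = restriction false , restriction true
      where
      restriction : ∀ a → str (restrict S x a) c
      restriction a f with proj₁ (str-section true) shattered f a
      ... | g , _ , p = g , p
    from : str S′ ∩ str S″ ⊆ section (str S) x true
    from {c} (shattered′ , shattered″) = proj₂ (str-section true) λ f a →
      let (g , p) = restriction a f in g , a , p
      where
      restriction : ∀ a → str (restrict S x a) c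
      restriction false = shattered′
      restriction true  = shattered″

  sstr-section-false : section (sstr S) x false ≐ sstr S′ ∪ sstr S″
  sstr-section-false = to , from
    where
    to : section (sstr S) x false ⊆ sstr S′ ∪ sstr S″
    to shattered with proj₁ (sstr-section false) shattered
    ... | g , false , p = inj₁ (g , λ f → p f false)
    ... | g , true  , p = inj₂ (g , λ f → p f false)
    from : sstr S′ ∪ sstr S″ ⊆ section (sstr S) x false
    from (inj₁ (g , p)) = proj₂ (sstr-section false) (g , false , λ f _ → p f)
    from (inj₂ (g , p)) = proj₂ (sstr-section false) (g , true , λ f _ → p f)

  sstr-section-true : section (sstr S) x true ≐ sstr (S′ ∩ˢ S″)
  sstr-section-true = to , from
    where
    to : section (sstr S) x true ⊆ sstr (S′ ∩ˢ S″)
    to shattered with proj₁ (sstr-section true) shattered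
    ... | g , _ , p = g , λ f → Equivalence.from T-∧ (p f false , p f true)
    from : sstr (S′ ∩ˢ S″) ⊆ section (sstr S) x true
    from (g , p) = proj₂ (sstr-section true) (g , false , λ f a → ∈∩ˢ⇒∈restrict a (p f))

  restrictions⇒SE : str (S′ ∪ˢ S″) ⊆ sstr S′ ∪ sstr S″ → str S′ ∩ str S″ ⊆ sstr (S′ ∩ˢ S″) → SE S
  restrictions⇒SE ∪ˢ⊆ ∩⊆ = sstr⊆str S , ⊆-by-sections {P = str S} {Q = sstr S} x
    (proj₂ sstr-section-false ∘ ∪ˢ⊆ ∘ proj₁ str-section-false)
    (proj₂ sstr-section-true ∘ ∩⊆ ∘ proj₁ str-section-true)

  ⊕-str : (str S′ ⊕⟨ x ⟩ str S″ ≐ str S) ⇔ (str (S′ ∪ˢ S″) ⊆ str S′ ∪ str S″)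
  ⊕-str = mk⇔ to from
    where
    to : str S′ ⊕⟨ x ⟩ str S″ ≐ str S → str (S′ ∪ˢ S″) ⊆ str S′ ∪ str S″
    to (_ , str⊆⊕) = proj₁ (⊕-section-false x) ∘ str⊆⊕ ∘ proj₂ str-section-false
    from : str (S′ ∪ˢ S″) ⊆ str S′ ∪ str S″ → str S′ ⊕⟨ x ⟩ str S″ ≐ str S
    from ∪ˢ⊆∪ =
      ⊆-by-sections {P = str S′ ⊕⟨ x ⟩ str S″} {Q = str S} x
        (proj₂ str-section-false ∘ str-∪⊆str-∪ˢ S′ S″ ∘ proj₁ (⊕-section-false x))
        (proj₂ str-section-true ∘ proj₁ (⊕-section-true x)) ,
      ⊆-by-sections {P = str S} {Q = str S′ ⊕⟨ x ⟩ str S″} x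
        (proj₂ (⊕-section-false x) ∘ ∪ˢ⊆∪ ∘ proj₁ str-section-false)
        (proj₂ (⊕-section-true x) ∘ proj₁ str-section-true)

  ⊕-sstr : (sstr S′ ⊕⟨ x ⟩ sstr S″ ≐ sstr S) ⇔ (sstr S′ ∩ sstr S″ ⊆ sstr (S′ ∩ˢ S″))
  ⊕-sstr = mk⇔ to from
    where
    to : sstr S′ ⊕⟨ x ⟩ sstr S″ ≐ sstr S → sstr S′ ∩ sstr S″ ⊆ sstr (S′ ∩ˢ S″)
    to (⊕⊆sstr , _) = proj₁ sstr-section-true ∘ ⊕⊆sstr ∘ proj₂ (⊕-section-true x)
    from : sstr S′ ∩ sstr S″ ⊆ sstr (S′ ∩ˢ S″) → sstr S′ ⊕⟨ x ⟩ sstr S″ ≐ sstr S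
    from ∩⊆∩ˢ =
      ⊆-by-sections {P = sstr S′ ⊕⟨ x ⟩ sstr S″} {Q = sstr S} x
        (proj₂ sstr-section-false ∘ proj₁ (⊕-section-false x))
        (proj₂ sstr-section-true ∘ ∩⊆∩ˢ ∘ proj₁ (⊕-section-true x)) ,
      ⊆-by-sections {P = sstr S} {Q = sstr S′ ⊕⟨ x ⟩ sstr S″} x
        (proj₂ (⊕-section-false x) ∘ proj₁ sstr-section-false)
        (proj₂ (⊕-section-true x) ∘ sstr-∩ˢ⊆sstr-∩ S′ S″ ∘ proj₁ sstr-section-true)

  #-split : # S ≡ # S′ + # S″
  #-split = count-sections x (λ v → T? (S v))

  #str-split : #str S ≡ #str (S′ ∪ˢ S″) + count (str? S′ ∩? str? S″)
  #str-split = trans (count-sections x (str? S))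
    (cong₂ _+_ (count-cong _ _ str-section-false) (count-cong _ _ str-section-true))

  #sstr-split : #sstr S ≡ count (sstr? S′ ∪? sstr? S″) + #sstr (S′ ∩ˢ S″)
  #sstr-split = trans (count-sections x (sstr? S))
    (cong₂ _+_ (count-cong _ _ sstr-section-false) (count-cong _ _ sstr-section-true))

  #str-restrictions≤#str : #str S′ + #str S″ ≤ #str S
  #str-restrictions≤#str = begin
    #str S′ + #str S″
      ≡⟨ count-∪+count-∩ (str? S′) (str? S″) ⟨
    count (str? S′ ∪? str? S″) + count (str? S′ ∩? str? S″)
      ≤⟨ +-monoˡ-≤ _ (count-mono (str? S′ ∪? str? S″) (str? (S′ ∪ˢ S″)) (str-∪⊆str-∪ˢ S′ S″)) ⟩
    #str (S′ ∪ˢ S″) + count (str? S′ ∩? str? S″)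
      ≡⟨ #str-split ⟨
    #str S
      ∎
    where open ≤-Reasoning

  #sstr≤#sstr-restrictions : #sstr S ≤ #sstr S′ + #sstr S″
  #sstr≤#sstr-restrictions = begin
    #sstr S
      ≡⟨ #sstr-split ⟩
    count (sstr? S′ ∪? sstr? S″) + #sstr (S′ ∩ˢ S″)
      ≤⟨ +-monoʳ-≤ _ (count-mono (sstr? (S′ ∩ˢ S″)) (sstr? S′ ∩? sstr? S″) (sstr-∩ˢ⊆sstr-∩ S′ S″)) ⟩
    count (sstr? S′ ∪? sstr? S″) + count (sstr? S′ ∩? sstr? S″)
      ≡⟨ count-∪+count-∩ (sstr? S′) (sstr? S″) ⟩
    #sstr S′ + #sstr S″
      ∎
    where open ≤-Reasoning

#≤#str : ∀ {m} (S : System m) → # S ≤ #str S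
#≤#str {zero} S = count-mono (λ v → T? (S v)) (str? S) λ { {[]} p [] → [] , p }
#≤#str {suc n} S = begin
  # S                    ≡⟨ #-split ⟩
  # S′ + # S″            ≤⟨ +-mono-≤ (#≤#str S′) (#≤#str S″) ⟩
  #str S′ + #str S″      ≤⟨ #str-restrictions≤#str ⟩
  #str S                 ∎
  where
  open Split S zero
  open ≤-Reasoning

#sstr≤# : ∀ {m} (S : System m) → #sstr S ≤ # S
#sstr≤# {zero} S = count-mono (sstr? S) (λ v → T? (S v)) λ { {[]} ([] , p) → p [] }
#sstr≤# {suc n} S = begin
  #sstr S                ≤⟨ #sstr≤#sstr-restrictions ⟩
  #sstr S′ + #sstr S″    ≤⟨ +-mono-≤ (#sstr≤# S′) (#sstr≤# S″) ⟩
  # S′ + # S″            ≡⟨ #-split ⟨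
  # S                    ∎
  where
  open Split S zero
  open ≤-Reasoning

module SplitCounting {n} (S : System (suc n)) (x : Fin (suc n)) where
  open Split S x
  open ≤-Reasoning

  #str≤#⇔ : #str S ≤ # S ⇔ (#str S′ ≤ # S′ × #str S″ ≤ # S″ × str (S′ ∪ˢ S″) ⊆ str S′ ∪ str S″)
  #str≤#⇔ = mk⇔ to from
    where
    ∩# = count (str? S′ ∩? str? S″)
    ∪# = count (str? S′ ∪? str? S″)

    to : #str S ≤ # S → #str S′ ≤ # S′ × #str S″ ≤ # S″ × str (S′ ∪ˢ S″) ⊆ str S′ ∪ str S″
    to #str≤# = proj₁ tight , proj₂ tight ,
                ⊆-count-≤⇒⊇ (str? S′ ∪? str? S″) (str? (S′ ∪ˢ S″)) (str-∪⊆str-∪ˢ S′ S″) #str-∪ˢ≤∪#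
      where
      tight = +-mono-≤-tight (#≤#str S′) (#≤#str S″) (begin
        #str S′ + #str S″   ≤⟨ #str-restrictions≤#str ⟩
        #str S              ≤⟨ #str≤# ⟩
        # S                 ≡⟨ #-split ⟩
        # S′ + # S″         ∎)
      #str-∪ˢ≤∪# : #str (S′ ∪ˢ S″) ≤ ∪#
      #str-∪ˢ≤∪# = +-cancelʳ-≤ ∩# _ _ (begin
        #str (S′ ∪ˢ S″) + ∩#  ≡⟨ #str-split ⟨
        #str S                ≤⟨ #str≤# ⟩
        # S                   ≡⟨ #-split ⟩
        # S′ + # S″           ≤⟨ +-mono-≤ (#≤#str S′) (#≤#str S″) ⟩
        #str S′ + #str S″     ≡⟨ count-∪+count-∩ (str? S′) (str? S″) ⟨
        ∪# + ∩#               ∎)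

    from : #str S′ ≤ # S′ × #str S″ ≤ # S″ × str (S′ ∪ˢ S″) ⊆ str S′ ∪ str S″ → #str S ≤ # S
    from (#str′≤#′ , #str″≤#″ , ∪ˢ⊆∪) = begin
      #str S                ≡⟨ #str-split ⟩
      #str (S′ ∪ˢ S″) + ∩#  ≤⟨ +-monoˡ-≤ ∩# (count-mono (str? (S′ ∪ˢ S″)) (str? S′ ∪? str? S″) ∪ˢ⊆∪) ⟩
      ∪# + ∩#               ≡⟨ count-∪+count-∩ (str? S′) (str? S″) ⟩
      #str S′ + #str S″     ≤⟨ +-mono-≤ #str′≤#′ #str″≤#″ ⟩
      # S′ + # S″           ≡⟨ #-split ⟨
      # S                   ∎

  #str≤#⇒∩ˢ : #str S ≤ # S →
              #str (S′ ∩ˢ S″) ≤ # (S′ ∩ˢ S″) × str S′ ∩ str S″ ⊆ str (S′ ∩ˢ S″)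
  #str≤#⇒∩ˢ #str≤# =
    ≤-trans #str-∩ˢ≤∩# ∩#≤#∩ˢ ,
    ⊆-count-≤⇒⊇ (str? (S′ ∩ˢ S″)) (str? S′ ∩? str? S″) (str-∩ˢ⊆str-∩ S′ S″)
                (≤-trans ∩#≤#∩ˢ (#≤#str (S′ ∩ˢ S″)))
    where
    ∩# = count (str? S′ ∩? str? S″)
    #str-∩ˢ≤∩# : #str (S′ ∩ˢ S″) ≤ ∩#
    #str-∩ˢ≤∩# = count-mono (str? (S′ ∩ˢ S″)) (str? S′ ∩? str? S″) (str-∩ˢ⊆str-∩ S′ S″)
    ∩#≤#∩ˢ : ∩# ≤ # (S′ ∩ˢ S″)
    ∩#≤#∩ˢ = +-cancelˡ-≤ (#str (S′ ∪ˢ S″)) _ _ (begin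
      #str (S′ ∪ˢ S″) + ∩#              ≡⟨ #str-split ⟨
      #str S                            ≤⟨ #str≤# ⟩
      # S                               ≡⟨ #-split ⟩
      # S′ + # S″                       ≡⟨ #∪ˢ+#∩ˢ S′ S″ ⟨
      # (S′ ∪ˢ S″) + # (S′ ∩ˢ S″)       ≤⟨ +-monoˡ-≤ _ (#≤#str (S′ ∪ˢ S″)) ⟩
      #str (S′ ∪ˢ S″) + # (S′ ∩ˢ S″)    ∎)

  #≤#sstr⇔ : # S ≤ #sstr S ⇔ (# S′ ≤ #sstr S′ × # S″ ≤ #sstr S″ × sstr S′ ∩ sstr S″ ⊆ sstr (S′ ∩ˢ S″))
  #≤#sstr⇔ = mk⇔ to from
    where
    ∩# = count (sstr? S′ ∩? sstr? S″)
    ∪# = count (sstr? S′ ∪? sstr? S″)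

    to : # S ≤ #sstr S → # S′ ≤ #sstr S′ × # S″ ≤ #sstr S″ × sstr S′ ∩ sstr S″ ⊆ sstr (S′ ∩ˢ S″)
    to #≤#sstr = proj₁ tight , proj₂ tight ,
                 ⊆-count-≤⇒⊇ (sstr? (S′ ∩ˢ S″)) (sstr? S′ ∩? sstr? S″) (sstr-∩ˢ⊆sstr-∩ S′ S″) ∩#≤#sstr-∩ˢ
      where
      tight = +-mono-≤-tight (#sstr≤# S′) (#sstr≤# S″) (begin
        # S′ + # S″           ≡⟨ #-split ⟨
        # S                   ≤⟨ #≤#sstr ⟩
        #sstr S               ≤⟨ #sstr≤#sstr-restrictions ⟩
        #sstr S′ + #sstr S″   ∎)
      ∩#≤#sstr-∩ˢ : ∩# ≤ #sstr (S′ ∩ˢ S″)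
      ∩#≤#sstr-∩ˢ = +-cancelˡ-≤ ∪# _ _ (begin
        ∪# + ∩#                 ≡⟨ count-∪+count-∩ (sstr? S′) (sstr? S″) ⟩
        #sstr S′ + #sstr S″     ≤⟨ +-mono-≤ (#sstr≤# S′) (#sstr≤# S″) ⟩
        # S′ + # S″             ≡⟨ #-split ⟨
        # S                     ≤⟨ #≤#sstr ⟩
        #sstr S                 ≡⟨ #sstr-split ⟩
        ∪# + #sstr (S′ ∩ˢ S″)   ∎)

    from : # S′ ≤ #sstr S′ × # S″ ≤ #sstr S″ × sstr S′ ∩ sstr S″ ⊆ sstr (S′ ∩ˢ S″) → # S ≤ #sstr S
    from (#′≤#sstr′ , #″≤#sstr″ , ∩⊆∩ˢ) = begin
      # S                     ≡⟨ #-split ⟩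
      # S′ + # S″             ≤⟨ +-mono-≤ #′≤#sstr′ #″≤#sstr″ ⟩
      #sstr S′ + #sstr S″     ≡⟨ count-∪+count-∩ (sstr? S′) (sstr? S″) ⟨
      ∪# + ∩#                 ≤⟨ +-monoʳ-≤ ∪# (count-mono (sstr? S′ ∩? sstr? S″) (sstr? (S′ ∩ˢ S″)) ∩⊆∩ˢ) ⟩
      ∪# + #sstr (S′ ∩ˢ S″)   ≡⟨ #sstr-split ⟨
      #sstr S                 ∎

  #≤#sstr⇒∪ˢ : # S ≤ #sstr S →
               # (S′ ∪ˢ S″) ≤ #sstr (S′ ∪ˢ S″) × sstr (S′ ∪ˢ S″) ⊆ sstr S′ ∪ sstr S″
  #≤#sstr⇒∪ˢ #≤#sstr =
    ≤-trans #∪ˢ≤∪# ∪#≤#sstr-∪ˢ ,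
    ⊆-count-≤⇒⊇ (sstr? S′ ∪? sstr? S″) (sstr? (S′ ∪ˢ S″)) (sstr-∪⊆sstr-∪ˢ S′ S″)
                (≤-trans (#sstr≤# (S′ ∪ˢ S″)) #∪ˢ≤∪#)
    where
    ∪# = count (sstr? S′ ∪? sstr? S″)
    ∪#≤#sstr-∪ˢ : ∪# ≤ #sstr (S′ ∪ˢ S″)
    ∪#≤#sstr-∪ˢ = count-mono (sstr? S′ ∪? sstr? S″) (sstr? (S′ ∪ˢ S″)) (sstr-∪⊆sstr-∪ˢ S′ S″)
    #∪ˢ≤∪# : # (S′ ∪ˢ S″) ≤ ∪#
    #∪ˢ≤∪# = +-cancelʳ-≤ (# (S′ ∩ˢ S″)) _ _ (begin
      # (S′ ∪ˢ S″) + # (S′ ∩ˢ S″)       ≡⟨ #∪ˢ+#∩ˢ S′ S″ ⟩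
      # S′ + # S″                       ≡⟨ #-split ⟨
      # S                               ≤⟨ #≤#sstr ⟩
      #sstr S                           ≡⟨ #sstr-split ⟩
      ∪# + #sstr (S′ ∩ˢ S″)             ≤⟨ +-monoʳ-≤ ∪# (#sstr≤# (S′ ∩ˢ S″)) ⟩
      ∪# + # (S′ ∩ˢ S″)                 ∎)

SE-zero : (S : System 0) → SE S
SE-zero S = sstr⊆str S , λ { {[]} shattered → strongly (shattered []) }
  where
  strongly : ∃ (λ g → glue [] g [] ∈S S) → sstr S []
  strongly ([] , p) = [] , λ { [] → p }

#str≤#⇒SE : ∀ {m} (S : System m) → #str S ≤ # S → SE S
#str≤#⇒SE {zero} S _ = SE-zero S
#str≤#⇒SE {suc n} S #str≤# =
  let (#str′≤#′ , #str″≤#″ , ∪ˢ⊆∪) = Equivalence.to #str≤#⇔ #str≤#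
      (#str-∩ˢ≤#∩ˢ , ∩⊆∩ˢ) = #str≤#⇒∩ˢ #str≤#
  in restrictions⇒SE
       (⊎-map (proj₂ (#str≤#⇒SE S′ #str′≤#′)) (proj₂ (#str≤#⇒SE S″ #str″≤#″)) ∘ ∪ˢ⊆∪)
       (proj₂ (#str≤#⇒SE (S′ ∩ˢ S″) #str-∩ˢ≤#∩ˢ) ∘ ∩⊆∩ˢ)
  where
  open Split S zero
  open SplitCounting S zero

#≤#sstr⇒SE : ∀ {m} (S : System m) → # S ≤ #sstr S → SE S
#≤#sstr⇒SE {zero} S _ = SE-zero S
#≤#sstr⇒SE {suc n} S #≤#sstr =
  let (#′≤#sstr′ , #″≤#sstr″ , ∩⊆∩ˢ) = Equivalence.to #≤#sstr⇔ #≤#sstr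
      (#∪ˢ≤#sstr-∪ˢ , ∪ˢ⊆∪) = #≤#sstr⇒∪ˢ #≤#sstr
  in restrictions⇒SE
       (∪ˢ⊆∪ ∘ proj₂ (#≤#sstr⇒SE (S′ ∪ˢ S″) #∪ˢ≤#sstr-∪ˢ))
       (∩⊆∩ˢ ∘ ×-map (proj₂ (#≤#sstr⇒SE S′ #′≤#sstr′)) (proj₂ (#≤#sstr⇒SE S″ #″≤#sstr″)))
  where
  open Split S zero
  open SplitCounting S zero

SE⇔#str≤# : ∀ {m} (S : System m) → SE S ⇔ #str S ≤ # S
SE⇔#str≤# S = mk⇔
  (λ (_ , str⊆sstr) → ≤-trans (count-mono (str? S) (sstr? S) str⊆sstr) (#sstr≤# S))
  (#str≤#⇒SE S)

SE⇔#≤#sstr : ∀ {m} (S : System m) → SE S ⇔ # S ≤ #sstr S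
SE⇔#≤#sstr S = mk⇔
  (λ (_ , str⊆sstr) → ≤-trans (#≤#str S) (count-mono (str? S) (sstr? S) str⊆sstr))
  (#≤#sstr⇒SE S)

mainTheorem10 : ∀ {n} (S : System (suc n)) (x : Fin (suc n)) →
    let S′ = restrict S x false
        S″ = restrict S x true
    in (SE S ⇔ (SE S′ × SE S″ × ((str S′ ⊕⟨ x ⟩ str S″) ≐ str S)))
     × (SE S ⇔ (SE S′ × SE S″ × ((sstr S′ ⊕⟨ x ⟩ sstr S″) ≐ sstr S)))
mainTheorem10 S x =
  ⇔-trans (SE⇔#str≤# S)
    (⇔-trans #str≤#⇔ (⇔-sym (SE⇔#str≤# S′) ×-⇔ ⇔-sym (SE⇔#str≤# S″) ×-⇔ ⇔-sym ⊕-str)) ,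
  ⇔-trans (SE⇔#≤#sstr S)
    (⇔-trans #≤#sstr⇔ (⇔-sym (SE⇔#≤#sstr S′) ×-⇔ ⇔-sym (SE⇔#≤#sstr S″) ×-⇔ ⇔-sym ⊕-sstr))
  where
  open Split S x
  open SplitCounting S x
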